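{- Let $G$ be a graph containing no triangle $K_3$ and no induced path $P_5$ on five vertices. Then $z(G)\le 3$.
   Context: A proper coloring with colors $1,\dots,k$ is a Grundy coloring if for any $i<j$, every vertex of color $j$ has a neighbor of color $i$. A vertex of color $i$ is color-dominating if it has a neighbor of every other color $j\neq i$ used. A $z$-coloring of $G$ is a proper coloring using $k$ colors which is a Grundy coloring, in which every color class contains a color-dominating vertex, and which contains color-dominating vertices $u_1,\dots,u_k$ with $u_j$ of color $j$ and $u_k$ adjacent to $u_j$ for every $j\neq k$. $z(G)$ is the maximum number of colors in a $z$-coloring of $G$. -}

module Defs where

open import Data.Nat using (ℕ; suc; _+_; _<_)
open import Data.Fin using (Fin; toℕ)
open import Data.Bool using (Bool; true; false)
open import Data.Product using (Σ; ∃; _×_; _,_)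
open import Relation.Nullary using (¬_)
open import Relation.Binary.PropositionalEquality using (_≡_; _≢_)

record Graph (n : ℕ) : Set where
  field
    adj    : Fin n → Fin n → Bool
    sym    : ∀ u v → adj u v ≡ adj v u
    irrefl : ∀ v → adj v v ≡ false
open Graph public

module _ {n : ℕ} (G : Graph n) where

  Adj : Fin n → Fin n → Set
  Adj u v = adj G u v ≡ true

  HasTriangle : Set
  HasTriangle = Σ (Fin n) λ a → Σ (Fin n) λ b → Σ (Fin n) λ c →
                Adj a b × Adj b c × Adj a c

  P5adj : Fin 5 → Fin 5 → Bool
  P5adj i j with toℕ i | toℕ j
  ... | a | b = step a b
    where
      step : ℕ → ℕ → Bool
      step 0 1 = true
      step 1 0 = true
      step 1 2 = true
      step 2 1 = true
      step 2 3 = true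
      step 3 2 = true
      step 3 4 = true
      step 4 3 = true
      step _ _ = false

  HasInducedP5 : Set
  HasInducedP5 = Σ (Fin 5 → Fin n) λ f →
                 (∀ i j → f i ≡ f j → i ≡ j) ×
                 (∀ i j → adj G (f i) (f j) ≡ P5adj i j)

  module _ {k : ℕ} (c : Fin n → Fin k) where
    -- colors are 0,…,k-1 (paper's 1,…,k shifted by one)

    Proper : Set
    Proper = ∀ u v → Adj u v → c u ≢ c v

    Grundy : Set
    Grundy = ∀ v (i : Fin k) → toℕ i < toℕ (c v) →
             Σ (Fin n) λ w → Adj v w × c w ≡ i

    ColorDominating : Fin n → Set
    ColorDominating v = ∀ (j : Fin k) → j ≢ c v →
                        Σ (Fin n) λ w → Adj v w × c w ≡ j

    record IsZColoring : Set where
      field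
        proper    : Proper
        surjective : ∀ (j : Fin k) → Σ (Fin n) λ v → c v ≡ j
        grundy    : Grundy
        classDom  : ∀ (j : Fin k) → Σ (Fin n) λ v → c v ≡ j × ColorDominating v
        u         : Fin k → Fin n
        u-color   : ∀ j → c (u j) ≡ j
        u-dom     : ∀ j → ColorDominating (u j)
        u-last    : ∀ (l j : Fin k) → suc (toℕ l) ≡ k → j ≢ l → Adj (u l) (u j)

  HasZColoring : ℕ → Set
  HasZColoring k = Σ (Fin n → Fin k) λ c → IsZColoring c

module Submission where

-- Suppose k ≥ 4. Let ℓ be the colour-dominating vertex of the last colour and u₀, u₁, u₂
-- those of colours 0, 1, 2; triangle-freeness makes ℓ; u₀, u₁, u₂ an induced claw.
-- Take neighbours w of u₁ and x of u₂ coloured 2 and 1, and neighbours q, r of u₀ coloured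
-- 1 and 2. Properness and triangle-freeness fix almost every adjacency among these
-- vertices, and whichever way the few remaining ones fall, five of them induce a P₅.

open import Defs
open import Data.Nat using (ℕ; _≤_; _+_; suc; z≤n; s≤s)
open import Data.Fin using (Fin; #_; fromℕ) renaming (zero to fzero; suc to fsuc)
open import Data.Fin.Properties using (toℕ-fromℕ)
open import Data.Bool using (Bool; true; false; if_then_else_)
open import Data.Product using (Σ; _×_; _,_)
open import Data.Sum using (_⊎_; inj₁; inj₂)
open import Data.Empty using (⊥; ⊥-elim)
open import Relation.Nullary using (¬_)
open import Relation.Binary.PropositionalEquality
  using (_≡_; _≢_; refl; trans; cong; module ≡-Reasoning) renaming (sym to ≡-sym)

-- A left inverse of i ↦ P5adj i: distinct vertices of P₅ have distinct neighbourhoods.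
P5-index : (Fin 5 → Bool) → Fin 5
P5-index r =
  if r (# 1) then (if r (# 3) then # 2 else # 0)
  else (if r (# 0) then # 1 else if r (# 2) then # 3 else # 4)

P5-index-cong : ∀ {r s : Fin 5 → Bool} → (∀ i → r i ≡ s i) → P5-index r ≡ P5-index s
P5-index-cong h rewrite h (# 0) | h (# 1) | h (# 2) | h (# 3) = refl

module _ {n : ℕ} (G : Graph n) where

  _~_ _≁_ : Fin n → Fin n → Set
  a ~ b = Adj G a b
  a ≁ b = adj G a b ≡ false

  adjacency : ∀ a b → a ~ b ⊎ a ≁ b
  adjacency a b with adj G a b
  ... | true  = inj₁ refl
  ... | false = inj₂ refl

  adj-sym : ∀ {a b} {v : Bool} → adj G a b ≡ v → adj G b a ≡ v
  adj-sym {a} {b} e = trans (sym G b a) e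

  P5-index-row : ∀ i → P5-index (P5adj G i) ≡ i
  P5-index-row fzero                             = refl
  P5-index-row (fsuc fzero)                      = refl
  P5-index-row (fsuc (fsuc fzero))               = refl
  P5-index-row (fsuc (fsuc (fsuc fzero)))        = refl
  P5-index-row (fsuc (fsuc (fsuc (fsuc fzero)))) = refl

  P5adj-row-injective : ∀ i j → (∀ m → P5adj G i m ≡ P5adj G j m) → i ≡ j
  P5adj-row-injective i j h = begin
    i                     ≡⟨ P5-index-row i ⟨
    P5-index (P5adj G i)  ≡⟨ P5-index-cong h ⟩
    P5-index (P5adj G j)  ≡⟨ P5-index-row j ⟩
    j                     ∎
    where open ≡-Reasoning

  inducedP5 : ∀ a b c d e → a ~ b → b ~ c → c ~ d → d ~ e →
              a ≁ c → a ≁ d → a ≁ e → b ≁ d → b ≁ e → c ≁ e → HasInducedP5 G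
  inducedP5 a b c d e ab bc cd de ac ad ae bd be ce =
    f , f-injective , f-induced
    where
    f : Fin 5 → Fin n
    f fzero                             = a
    f (fsuc fzero)                      = b
    f (fsuc (fsuc fzero))               = c
    f (fsuc (fsuc (fsuc fzero)))        = d
    f (fsuc (fsuc (fsuc (fsuc fzero)))) = e

    f-induced : ∀ i j → adj G (f i) (f j) ≡ P5adj G i j
    f-induced fzero fzero = irrefl G a
    f-induced fzero (fsuc fzero) = ab
    f-induced fzero (fsuc (fsuc fzero)) = ac
    f-induced fzero (fsuc (fsuc (fsuc fzero))) = ad
    f-induced fzero (fsuc (fsuc (fsuc (fsuc fzero)))) = ae
    f-induced (fsuc fzero) fzero = adj-sym ab
    f-induced (fsuc fzero) (fsuc fzero) = irrefl G b
    f-induced (fsuc fzero) (fsuc (fsuc fzero)) = bc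
    f-induced (fsuc fzero) (fsuc (fsuc (fsuc fzero))) = bd
    f-induced (fsuc fzero) (fsuc (fsuc (fsuc (fsuc fzero)))) = be
    f-induced (fsuc (fsuc fzero)) fzero = adj-sym ac
    f-induced (fsuc (fsuc fzero)) (fsuc fzero) = adj-sym bc
    f-induced (fsuc (fsuc fzero)) (fsuc (fsuc fzero)) = irrefl G c
    f-induced (fsuc (fsuc fzero)) (fsuc (fsuc (fsuc fzero))) = cd
    f-induced (fsuc (fsuc fzero)) (fsuc (fsuc (fsuc (fsuc fzero)))) = ce
    f-induced (fsuc (fsuc (fsuc fzero))) fzero = adj-sym ad
    f-induced (fsuc (fsuc (fsuc fzero))) (fsuc fzero) = adj-sym bd
    f-induced (fsuc (fsuc (fsuc fzero))) (fsuc (fsuc fzero)) = adj-sym cd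
    f-induced (fsuc (fsuc (fsuc fzero))) (fsuc (fsuc (fsuc fzero))) = irrefl G d
    f-induced (fsuc (fsuc (fsuc fzero))) (fsuc (fsuc (fsuc (fsuc fzero)))) = de
    f-induced (fsuc (fsuc (fsuc (fsuc fzero)))) fzero = adj-sym ae
    f-induced (fsuc (fsuc (fsuc (fsuc fzero)))) (fsuc fzero) = adj-sym be
    f-induced (fsuc (fsuc (fsuc (fsuc fzero)))) (fsuc (fsuc fzero)) = adj-sym ce
    f-induced (fsuc (fsuc (fsuc (fsuc fzero)))) (fsuc (fsuc (fsuc fzero))) = adj-sym de
    f-induced (fsuc (fsuc (fsuc (fsuc fzero)))) (fsuc (fsuc (fsuc (fsuc fzero)))) = irrefl G e

    f-injective : ∀ i j → f i ≡ f j → i ≡ j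
    f-injective i j fi≡fj = P5adj-row-injective i j λ m →
      trans (≡-sym (f-induced i m)) (trans (cong (λ v → adj G v (f m)) fi≡fj) (f-induced j m))

  sameColour⇒≁ : ∀ {k} {c : Fin n → Fin k} → Proper G c →
                 ∀ {a b j} → c a ≡ j → c b ≡ j → a ≁ b
  sameColour⇒≁ proper {a} {b} ca cb with adjacency a b
  ... | inj₁ a~b = ⊥-elim (proper a b a~b (trans ca (≡-sym cb)))
  ... | inj₂ a≁b = a≁b

  module _ (noTriangle : ¬ HasTriangle G) (noP5 : ¬ HasInducedP5 G) where

    common-neighbour⇒≁ : ∀ {a b d} → a ~ b → a ~ d → b ≁ d
    common-neighbour⇒≁ {a} {b} {d} a~b a~d with adjacency b d
    ... | inj₁ b~d = ⊥-elim (noTriangle (a , b , d , a~b , b~d , a~d))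
    ... | inj₂ b≁d = b≁d

    ¬bridgedClaw : ∀ {ℓ u₀ u₁ u₂ w x q} →
      ℓ ~ u₀ → ℓ ~ u₁ → ℓ ~ u₂ → u₁ ~ w → w ~ x → u₂ ~ x →
      w ≁ u₂ → u₀ ~ w → u₀ ~ q → q ≁ u₁ → q ≁ x → ⊥
    ¬bridgedClaw {ℓ} {u₀} {u₁} {u₂} {w} {x} {q}
                 ℓ~u₀ ℓ~u₁ ℓ~u₂ u₁~w w~x u₂~x w≁u₂ u₀~w u₀~q q≁u₁ q≁x
      with adjacency q u₂
    ... | inj₂ q≁u₂ = noP5 (inducedP5 q u₀ ℓ u₂ x
            (adj-sym u₀~q) (adj-sym ℓ~u₀) ℓ~u₂ u₂~x
            q≁ℓ q≁u₂ q≁x u₀≁u₂ u₀≁x ℓ≁x)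
      where
      q≁ℓ : q ≁ ℓ
      q≁ℓ = common-neighbour⇒≁ u₀~q (adj-sym ℓ~u₀)
      u₀≁u₂ : u₀ ≁ u₂
      u₀≁u₂ = common-neighbour⇒≁ ℓ~u₀ ℓ~u₂
      u₀≁x : u₀ ≁ x
      u₀≁x = common-neighbour⇒≁ (adj-sym u₀~w) w~x
      ℓ≁x : ℓ ≁ x
      ℓ≁x = common-neighbour⇒≁ (adj-sym ℓ~u₂) u₂~x
    ... | inj₁ q~u₂ = noP5 (inducedP5 u₁ w u₀ q u₂
            u₁~w (adj-sym u₀~w) u₀~q q~u₂
            u₁≁u₀ (adj-sym q≁u₁) u₁≁u₂ w≁q w≁u₂ u₀≁u₂)
      where
      u₁≁u₀ : u₁ ≁ u₀
      u₁≁u₀ = common-neighbour⇒≁ ℓ~u₁ ℓ~u₀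
      u₁≁u₂ : u₁ ≁ u₂
      u₁≁u₂ = common-neighbour⇒≁ ℓ~u₁ ℓ~u₂
      w≁q : w ≁ q
      w≁q = common-neighbour⇒≁ u₀~w u₀~q
      u₀≁u₂ : u₀ ≁ u₂
      u₀≁u₂ = common-neighbour⇒≁ ℓ~u₀ ℓ~u₂

    ¬extendedClaw : ∀ {ℓ u₀ u₁ u₂ w x q r} →
      ℓ ~ u₀ → ℓ ~ u₁ → ℓ ~ u₂ →
      u₁ ~ w → w ≁ u₂ → u₂ ~ x → x ≁ u₁ →
      u₀ ~ q → q ≁ u₁ → q ≁ x →
      u₀ ~ r → r ≁ u₂ → r ≁ w → ⊥
    ¬extendedClaw {ℓ} {u₀} {u₁} {u₂} {w} {x} {q} {r}
                  ℓ~u₀ ℓ~u₁ ℓ~u₂ u₁~w w≁u₂ u₂~x x≁u₁ u₀~q q≁u₁ q≁x u₀~r r≁u₂ r≁w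
      = by-cases (adjacency w x) (adjacency u₀ w) (adjacency u₀ x)
      where
      w≁ℓ : w ≁ ℓ
      w≁ℓ = common-neighbour⇒≁ u₁~w (adj-sym ℓ~u₁)
      ℓ≁x : ℓ ≁ x
      ℓ≁x = common-neighbour⇒≁ (adj-sym ℓ~u₂) u₂~x

      by-cases : w ~ x ⊎ w ≁ x → u₀ ~ w ⊎ u₀ ≁ w → u₀ ~ x ⊎ u₀ ≁ x → ⊥
      by-cases (inj₂ w≁x) _ _ = noP5 (inducedP5 w u₁ ℓ u₂ x
        (adj-sym u₁~w) (adj-sym ℓ~u₁) ℓ~u₂ u₂~x
        w≁ℓ w≁u₂ w≁x (common-neighbour⇒≁ ℓ~u₁ ℓ~u₂) (adj-sym x≁u₁) ℓ≁x)
      by-cases (inj₁ w~x) (inj₁ u₀~w) _ = ¬bridgedClaw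
        ℓ~u₀ ℓ~u₁ ℓ~u₂ u₁~w w~x u₂~x w≁u₂ u₀~w u₀~q q≁u₁ q≁x
      by-cases (inj₁ w~x) _ (inj₁ u₀~x) = ¬bridgedClaw
        ℓ~u₀ ℓ~u₂ ℓ~u₁ u₂~x (adj-sym w~x) u₁~w x≁u₁ u₀~x u₀~r r≁u₂ r≁w
      by-cases (inj₁ w~x) (inj₂ u₀≁w) (inj₂ u₀≁x) = noP5 (inducedP5 u₀ ℓ u₁ w x
        (adj-sym ℓ~u₀) ℓ~u₁ u₁~w w~x
        (common-neighbour⇒≁ ℓ~u₀ ℓ~u₁) u₀≁w u₀≁x (adj-sym w≁ℓ) ℓ≁x (adj-sym x≁u₁))

    ¬zColoring≥4 : ∀ {m} (c : Fin n → Fin (4 + m)) → ¬ IsZColoring G c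
    ¬zColoring≥4 {m} c z =
      let (w , u₁~w , cw) = neighbour (# 1) (# 2) (λ ())
          (x , u₂~x , cx) = neighbour (# 2) (# 1) (λ ())
          (q , u₀~q , cq) = neighbour (# 0) (# 1) (λ ())
          (r , u₀~r , cr) = neighbour (# 0) (# 2) (λ ())
      in ¬extendedClaw (ℓ~ (# 0) (λ ())) (ℓ~ (# 1) (λ ())) (ℓ~ (# 2) (λ ()))
           u₁~w (same cw (u-color (# 2))) u₂~x (same cx (u-color (# 1)))
           u₀~q (same cq (u-color (# 1))) (same cq cx)
           u₀~r (same cr (u-color (# 2))) (same cr cw)
      where
      open IsZColoring z

      last : Fin (4 + m)
      last = fromℕ (3 + m)

      ℓ~ : ∀ j → j ≢ last → u last ~ u j
      ℓ~ j = u-last last j (cong suc (toℕ-fromℕ (3 + m)))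

      neighbour : ∀ i j → j ≢ i → Σ (Fin n) λ v → u i ~ v × c v ≡ j
      neighbour i j j≢i = u-dom i j (λ j≡c → j≢i (trans j≡c (u-color i)))

      same : ∀ {a b j} → c a ≡ j → c b ≡ j → a ≁ b
      same = sameColour⇒≁ proper

theorem3 : ∀ (n : ℕ) (G : Graph n) → ¬ HasTriangle G → ¬ HasInducedP5 G →
    ∀ (k : ℕ) → HasZColoring G k → k ≤ 3
theorem3 n G noTriangle noP5 (suc (suc (suc (suc m)))) (c , z) =
  ⊥-elim (¬zColoring≥4 G noTriangle noP5 c z)
theorem3 _ _ _ _ 0 _ = z≤n
theorem3 _ _ _ _ 1 _ = s≤s z≤n
theorem3 _ _ _ _ 2 _ = s≤s (s≤s z≤n)
theorem3 _ _ _ _ 3 _ = s≤s (s≤s (s≤s z≤n))
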